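{- Let $G$ be a simple connected undirected graph of girth $s$, let $v\in V(G)$, and let $k\ge2$. Suppose $G$ has $k$ pairwise level-disjoint level partitions $\mathcal{S}^1,\dots,\mathcal{S}^k$, all rooted at $v$, of optimal height, i.e. $\max_{1\le i\le k}h(\mathcal{S}^i)=\mathrm{ecc}(v)+k-1$ if $G$ is not bipartite and $\max_{1\le i\le k}h(\mathcal{S}^i)=\mathrm{ecc}(v)+2k-2$ if $G$ is bipartite. Then $\mathrm{ecc}(v)\ge s-2$ if $G$ is non-bipartite, and $\mathrm{ecc}(v)\ge s-3$ if $G$ is bipartite.
   Context: For a set $X\subseteq V(G)$, $N(X)$ denotes the set of vertices adjacent to some vertex of $X$. A level partition of $G$ is a partition $\mathcal{S}=(S_0,\dots,S_h)$ of $V(G)$ into a tuple of sets (levels) such that $S_i\subseteq N(S_{i-1})$ for every $1\le i\le h$; $h=h(\mathcal{S})$ is its height. It is rooted at $v$ if $S_0=\{v\}$. Two level partitions $\mathcal{S}=(S_0,\dots,S_{h})$ and $\mathcal{T}=(T_0,\dots,T_{h'})$ are level-disjoint if $S_i\cap T_i=\emptyset$ for every $1\le i\le\min(h,h')$. The girth is the length of a shortest cycle, and $\mathrm{ecc}(v)=\max_{u\in V(G)}d(u,v)$ is the eccentricity of $v$. -}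

module Defs where

open import Data.Nat using (ℕ; zero; suc; _+_; _≤_; _<_)
open import Data.Fin using (Fin; toℕ; fromℕ) renaming (zero to fzero)
open import Data.Bool using (Bool)
open import Data.Product using (Σ; ∃; _×_; _,_)
open import Relation.Nullary using (¬_)
open import Relation.Unary using (Decidable)
open import Relation.Binary using () renaming (Decidable to Decidable₂)
open import Relation.Binary.PropositionalEquality using (_≡_; _≢_)
open import Function.Definitions using (Injective)

record Graph : Set₁ where
  field
    n      : ℕ
    Adj    : Fin n → Fin n → Set
    Adj?   : Decidable₂ Adj
    sym    : ∀ {u w} → Adj u w → Adj w u
    irrefl : ∀ {u} → ¬ Adj u u

module _ (G : Graph) where
  open Graph G

  V : Set
  V = Fin n

  data Walk : V → V → ℕ → Set where
    here : ∀ {u} → Walk u u 0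
    step : ∀ {u w x ℓ} → Adj u w → Walk w x ℓ → Walk u x (suc ℓ)

  Connected : Set
  Connected = ∀ u w → ∃ λ ℓ → Walk u w ℓ

  Dist : V → V → ℕ → Set
  Dist u w d = Walk u w d × (∀ ℓ → Walk u w ℓ → d ≤ ℓ)

  IsEcc : V → ℕ → Set
  IsEcc v e = (∀ u → ∃ λ d → Dist u v d × d ≤ e) × (∃ λ u → Dist u v e)

  Cycle : ℕ → Set
  Cycle zero = Data.Empty.⊥ where import Data.Empty
  Cycle (suc m) =
    Σ (Fin (suc m) → V) λ c →
      (3 ≤ suc m) × Injective _≡_ _≡_ c
      × (∀ i j → suc (toℕ i) ≡ toℕ j → Adj (c i) (c j))
      × Adj (c (fromℕ m)) (c fzero)

  IsGirth : ℕ → Set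
  IsGirth s = Cycle s × (∀ ℓ → Cycle ℓ → s ≤ ℓ)

  Bipartite : Set
  Bipartite = Σ (V → Bool) λ f → ∀ u w → Adj u w → f u ≢ f w

  -- A level partition (S_0,…,S_h), encoded by the level of each vertex:
  -- S_i = { u | level u ≡ i }. Levels are nonempty (partition parts),
  -- and S_i ⊆ N(S_{i-1}) for 1 ≤ i ≤ h.
  record LevelPartition : Set where
    field
      height   : ℕ
      level    : V → ℕ
      bounded  : ∀ u → level u ≤ height
      nonempty : ∀ i → i ≤ height → ∃ λ u → level u ≡ i
      adjacent : ∀ u i → level u ≡ suc i → ∃ λ w → Adj w u × level w ≡ i
  open LevelPartition public

  RootedAt : LevelPartition → V → Set
  RootedAt S v = ∀ u → (level S u ≡ 0 → u ≡ v) × (u ≡ v → level S u ≡ 0)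

  LevelDisjoint : LevelPartition → LevelPartition → Set
  LevelDisjoint S T = ∀ i → 1 ≤ i → i ≤ height S → i ≤ height T →
    ∀ u → ¬ (level S u ≡ i × level T u ≡ i)

  MaxHeight : ∀ {k} → (Fin k → LevelPartition) → ℕ → Set
  MaxHeight P H = (∀ i → height (P i) ≤ H) × (∃ λ i → height (P i) ≡ H)

-- Take a neighbour y of v.  Level-disjointness puts y on pairwise distinct
-- levels ℓ₁,…,ℓ_k ≥ 1 of the k partitions; y is on level 1 in one of them,
-- hence on level ≥ 2 in the others.  Walking down the levels of such a
-- partition from y to v and closing with the edge vy gives a cycle of length
-- ℓᵢ + 1, so s ≤ ℓᵢ + 1.  The heights bound the ℓᵢ, and by pigeonhole the
-- k - 1 distinct values cannot all exceed e + 1; in the bipartite case every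
-- ℓᵢ is odd, and the same count on the halves ⌊ℓᵢ/2⌋ gives some ℓᵢ ≤ e + 2.
module Submission where

open import Defs
open import Data.Nat using (ℕ; zero; suc; _+_; _*_; _∸_; _≤_; _<_; _≤?_; s≤s; s≤s⁻¹; ⌊_/2⌋; ⌈_/2⌉)
open import Data.Nat.Properties
open import Data.Nat.Tactic.RingSolver using (solve-∀)
open import Data.Fin using (Fin; toℕ; fromℕ; fromℕ<) renaming (zero to fzero; suc to fsuc)
import Data.Fin.Properties as Fin
open import Data.Bool using (Bool)
open import Data.Bool.Properties using (¬-not)
open import Data.Product using (∃; _×_; _,_; proj₁; proj₂)
open import Data.Empty using (⊥-elim)
open import Function using (_∘_)
open import Function.Definitions using (Injective)
open import Relation.Nullary using (¬_; yes; no; contradiction)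
open import Relation.Binary.PropositionalEquality
  using (_≡_; _≢_; refl; sym; trans; cong; subst; subst₂; ≢-sym)

pigeonhole-≤ : ∀ {m} c (f : Fin (suc m) → ℕ) → Injective _≡_ _≡_ f →
               (∀ i → f i ≤ m + c) → ∃ λ i → f i ≤ c
pigeonhole-≤ {m} c f f-inj f≤ with Fin.any? (λ i → f i ≤? c)
... | yes small = small
... | no ¬small = contradiction (Fin.injective⇒≤ shift-inj) 1+n≰n
  where
    open ≤-Reasoning

    c<f : ∀ i → c < f i
    c<f i = ≰⇒> (λ fi≤c → ¬small (i , fi≤c))

    shift< : ∀ i → f i ∸ suc c < m
    shift< i = begin-strict
      f i ∸ suc c         <⟨ ∸-monoˡ-< (s≤s (f≤ i)) (c<f i) ⟩
      suc (m + c) ∸ suc c ≡⟨ m+n∸n≡m m c ⟩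
      m                   ∎

    shift : Fin (suc m) → Fin m
    shift i = fromℕ< (shift< i)

    shift-inj : Injective _≡_ _≡_ shift
    shift-inj {i} {j} eq = f-inj (∸-cancelʳ-≡ (c<f i) (c<f j)
      (trans (sym (Fin.toℕ-fromℕ< (shift< i)))
             (trans (cong toℕ eq) (Fin.toℕ-fromℕ< (shift< j)))))

e+2[1+k]≡1+k+k+[1+e] : ∀ e k → e + 2 * suc k ≡ suc (k + k + suc e)
e+2[1+k]≡1+k+k+[1+e] = solve-∀

⌊k+k+n/2⌋≡k+⌊n/2⌋ : ∀ k n → ⌊ k + k + n /2⌋ ≡ k + ⌊ n /2⌋
⌊k+k+n/2⌋≡k+⌊n/2⌋ zero    n = refl
⌊k+k+n/2⌋≡k+⌊n/2⌋ (suc k) n =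
  trans (cong (λ m → ⌊ suc m + n /2⌋) (+-suc k k)) (cong suc (⌊k+k+n/2⌋≡k+⌊n/2⌋ k n))

m+m≤k+k+n⇒m≤k+⌊n/2⌋ : ∀ {m} k n → m + m ≤ k + k + n → m ≤ k + ⌊ n /2⌋
m+m≤k+k+n⇒m≤k+⌊n/2⌋ {m} k n le = begin
  m               ≡⟨ n≡⌊n+n/2⌋ m ⟩
  ⌊ m + m /2⌋     ≤⟨ ⌊n/2⌋-mono le ⟩
  ⌊ k + k + n /2⌋ ≡⟨ ⌊k+k+n/2⌋≡k+⌊n/2⌋ k n ⟩
  k + ⌊ n /2⌋     ∎
  where open ≤-Reasoning

m≤⌊n/2⌋⇒m+m≤n : ∀ {m} n → m ≤ ⌊ n /2⌋ → m + m ≤ n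
m≤⌊n/2⌋⇒m+m≤n {m} n le = begin
  m + m               ≤⟨ +-mono-≤ le (≤-trans le (⌊n/2⌋≤⌈n/2⌉ n)) ⟩
  ⌊ n /2⌋ + ⌈ n /2⌉   ≡⟨ ⌊n/2⌋+⌈n/2⌉≡n n ⟩
  n                   ∎
  where open ≤-Reasoning

module _ (G : Graph) where
  open Graph G using (Adj) renaming (sym to Adj-sym; irrefl to Adj-irrefl)

  Cycle⇒∃≢ : ∀ {ℓ} → Cycle G ℓ → (v : V G) → ∃ λ u → u ≢ v
  Cycle⇒∃≢ {suc zero} (_ , s≤s () , _) _
  Cycle⇒∃≢ {suc (suc _)} (c , _ , c-inj , _) v with c fzero Fin.≟ v
  ... | yes c₀≡v = c (fsuc fzero) , λ c₁≡v → Fin.0≢1+n (c-inj (trans c₀≡v (sym c₁≡v)))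
  ... | no c₀≢v  = c fzero , c₀≢v

  module _ (S : LevelPartition G) where

    -- path t lies on level j ∸ t, stated without truncated subtraction
    record Descent (j : ℕ) (u : V G) : Set where
      field
        path        : Fin (suc j) → V G
        start       : path fzero ≡ u
        path-level  : ∀ t → level S (path t) + toℕ t ≡ j
        consecutive : ∀ t t′ → suc (toℕ t) ≡ toℕ t′ → Adj (path t) (path t′)

    descend : ∀ j {u} → level S u ≡ j → Descent j u
    descend zero {u} lu = record
      { path        = λ _ → u
      ; start       = refl
      ; path-level  = λ { fzero → trans (+-identityʳ _) lu }
      ; consecutive = λ { fzero fzero () }
      }
    descend (suc j) {u} lu with adjacent S u j lu
    ... | w , w~u , lw = record
      { path        = path′
      ; start       = refl
      ; path-level  = path′-level
      ; consecutive = consecutive′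
      }
      where
        open Descent (descend j lw)

        path′ : Fin (suc (suc j)) → V G
        path′ fzero    = u
        path′ (fsuc t) = path t

        path′-level : ∀ t → level S (path′ t) + toℕ t ≡ suc j
        path′-level fzero    = trans (+-identityʳ _) lu
        path′-level (fsuc t) = trans (+-suc _ _) (cong suc (path-level t))

        consecutive′ : ∀ t t′ → suc (toℕ t) ≡ toℕ t′ → Adj (path′ t) (path′ t′)
        consecutive′ fzero    (fsuc fzero) _  = subst (Adj u) (sym start) (Adj-sym w~u)
        consecutive′ (fsuc t) (fsuc t′)    eq = consecutive t t′ (suc-injective eq)

    module _ {v : V G} (rooted : RootedAt G S v) where

      1≤level : ∀ {u} → u ≢ v → 1 ≤ level S u
      1≤level u≢v = n≢0⇒n>0 (λ l≡0 → u≢v (proj₁ (rooted _) l≡0))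

      1≤height : ∀ {u} → u ≢ v → 1 ≤ height S
      1≤height {u} u≢v = ≤-trans (1≤level u≢v) (bounded S u)

      root-neighbour : 1 ≤ height S → ∃ λ y → Adj v y × level S y ≡ 1
      root-neighbour 1≤h with nonempty S 1 1≤h
      ... | y , ly with adjacent S y 0 ly
      ...   | w , w~y , lw = y , subst (λ x → Adj x y) (proj₁ (rooted w) lw) w~y , ly

      cycle-through-root : ∀ {L y} → 2 ≤ L → Adj v y → level S y ≡ L → Cycle G (suc L)
      cycle-through-root {L} {y} 2≤L v~y ly =
        path , s≤s 2≤L , path-inj , consecutive , closing
        where
          open Descent (descend L ly)

          path-inj : Injective _≡_ _≡_ path
          path-inj {i} {j} eq = Fin.toℕ-injective (+-cancelˡ-≡ (level S (path j)) _ _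
            (trans (cong (λ x → level S x + toℕ i) (sym eq))
                   (trans (path-level i) (sym (path-level j)))))

          bottom : path (fromℕ L) ≡ v
          bottom = proj₁ (rooted _) (+-cancelʳ-≡ L _ 0
            (trans (cong (level S (path (fromℕ L)) +_) (sym (Fin.toℕ-fromℕ L)))
                   (path-level (fromℕ L))))

          closing : Adj (path (fromℕ L)) (path fzero)
          closing = subst₂ Adj (sym bottom) (sym start) v~y

      module _ (col : V G → Bool) (proper : ∀ u w → Adj u w → col u ≢ col w) where

        level-parity : ∀ j {u} → level S u ≡ j →
          (col u ≡ col v → ∃ λ q → j ≡ q + q) × (col u ≢ col v → ∃ λ q → j ≡ suc (q + q))
        level-parity zero lu =
          (λ _ → 0 , refl) , (λ u≢v → ⊥-elim (u≢v (cong col (proj₁ (rooted _) lu))))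
        level-parity (suc j) {u} lu with adjacent S u j lu
        ... | w , w~u , lw with level-parity j lw
        ...   | even-w , odd-w = even-u , odd-u
          where
            even-u : col u ≡ col v → ∃ λ q → suc j ≡ q + q
            even-u u≡v with odd-w (subst (col w ≢_) u≡v (proper w u w~u))
            ... | q , refl = suc q , cong suc (sym (+-suc q q))

            odd-u : col u ≢ col v → ∃ λ q → suc j ≡ suc (q + q)
            odd-u u≢v with even-w (trans (¬-not (proper w u w~u)) (sym (¬-not (≢-sym u≢v))))
            ... | q , refl = q , refl

  level-injective : ∀ {k} (P : Fin k → LevelPartition G) →
    (∀ i j → i ≢ j → LevelDisjoint G (P i) (P j)) →
    ∀ {u} → (∀ i → 1 ≤ level (P i) u) → Injective _≡_ _≡_ (λ i → level (P i) u)
  level-injective P disjoint {u} 1≤lv {i} {j} eq with i Fin.≟ j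
  ... | yes i≡j = i≡j
  ... | no  i≢j = ⊥-elim (disjoint i j i≢j _ (1≤lv i) (bounded (P i) u)
                    (subst (_≤ height (P j)) (sym eq) (bounded (P j) u)) u (refl , sym eq))

module RootNeighbour (G : Graph) {v : V G} {k : ℕ} (P : Fin (suc (suc k)) → LevelPartition G)
  (rooted : ∀ i → RootedAt G (P i) v) (disjoint : ∀ i j → i ≢ j → LevelDisjoint G (P i) (P j))
  {c : ℕ} (cycle : Cycle G c) where

  open Graph G using (Adj) renaming (irrefl to Adj-irrefl)

  private
    neighbour : ∃ λ y → Adj v y × level (P fzero) y ≡ 1
    neighbour = root-neighbour G (P fzero) (rooted fzero)
      (1≤height G (P fzero) (rooted fzero) (proj₂ (Cycle⇒∃≢ G cycle v)))

  y : V G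
  y = proj₁ neighbour

  v~y : Adj v y
  v~y = proj₁ (proj₂ neighbour)

  y≢v : y ≢ v
  y≢v y≡v = Adj-irrefl (subst (Adj v) y≡v v~y)

  ℓ : Fin (suc (suc k)) → ℕ
  ℓ i = level (P i) y

  ℓ-inj : Injective _≡_ _≡_ ℓ
  ℓ-inj = level-injective G P disjoint (λ i → 1≤level G (P i) (rooted i) y≢v)

  2≤ℓ : ∀ i → 2 ≤ ℓ (fsuc i)
  2≤ℓ i = ≤∧≢⇒< (1≤level G (P (fsuc i)) (rooted (fsuc i)) y≢v)
                (λ 1≡ℓ → Fin.0≢1+n (ℓ-inj (trans (proj₂ (proj₂ neighbour)) 1≡ℓ)))

  cycle-through-y : ∀ i → Cycle G (suc (ℓ (fsuc i)))
  cycle-through-y i = cycle-through-root G (P (fsuc i)) (rooted (fsuc i)) (2≤ℓ i) v~y refl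

  ∃-ℓ≤1+e : ∀ e → (∀ i → height (P i) ≤ e + suc k) → ∃ λ i → ℓ (fsuc i) ≤ suc e
  ∃-ℓ≤1+e e h≤ = pigeonhole-≤ (suc e) (ℓ ∘ fsuc) (Fin.suc-injective ∘ ℓ-inj) ℓ≤
    where
      ℓ≤ : ∀ i → ℓ (fsuc i) ≤ k + suc e
      ℓ≤ i = ≤-trans (bounded (P (fsuc i)) y)
                     (≤-trans (h≤ (fsuc i)) (≤-reflexive (trans (+-comm e (suc k)) (sym (+-suc k e)))))

  module _ (col : V G → Bool) (proper : ∀ u w → Adj u w → col u ≢ col w) where

    private
      odd : ∀ i → ∃ λ q → ℓ i ≡ suc (q + q)
      odd i = proj₂ (level-parity G (P i) (rooted i) col proper (ℓ i) refl)
                    (≢-sym (proper v y v~y))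

      half : Fin (suc k) → ℕ
      half i = proj₁ (odd (fsuc i))

      ℓ≡ : ∀ i → ℓ (fsuc i) ≡ suc (half i + half i)
      ℓ≡ i = proj₂ (odd (fsuc i))

      half-inj : Injective _≡_ _≡_ half
      half-inj {i} {j} eq = Fin.suc-injective (ℓ-inj
        (trans (ℓ≡ i) (trans (cong (λ q → suc (q + q)) eq) (sym (ℓ≡ j)))))

      half≤ : ∀ e → (∀ i → height (P i) ≤ e + (2 * suc (suc k) ∸ 2)) →
              ∀ i → half i ≤ k + ⌊ suc e /2⌋
      half≤ e h≤ i = m+m≤k+k+n⇒m≤k+⌊n/2⌋ k (suc e) (s≤s⁻¹ (begin
        suc (half i + half i)      ≡⟨ sym (ℓ≡ i) ⟩
        ℓ (fsuc i)                 ≤⟨ bounded (P (fsuc i)) y ⟩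
        height (P (fsuc i))        ≤⟨ h≤ (fsuc i) ⟩
        e + (2 * suc (suc k) ∸ 2)  ≡⟨ cong (e +_) (sym (*-distribˡ-∸ 2 (suc (suc k)) 1)) ⟩
        e + 2 * suc k              ≡⟨ e+2[1+k]≡1+k+k+[1+e] e k ⟩
        suc (k + k + suc e)        ∎))
        where open ≤-Reasoning

    ∃-ℓ≤2+e : ∀ e → (∀ i → height (P i) ≤ e + (2 * suc (suc k) ∸ 2)) →
              ∃ λ i → ℓ (fsuc i) ≤ suc (suc e)
    ∃-ℓ≤2+e e h≤ with pigeonhole-≤ ⌊ suc e /2⌋ half half-inj (half≤ e h≤)
    ... | i , half≤⌊1+e/2⌋ =
      i , ≤-trans (≤-reflexive (ℓ≡ i)) (s≤s (m≤⌊n/2⌋⇒m+m≤n (suc e) half≤⌊1+e/2⌋))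

proposition11 : (G : Graph) → Connected G → (s : ℕ) → IsGirth G s →
    (v : V G) → (k : ℕ) → 2 ≤ k → (e : ℕ) → IsEcc G v e →
    (P : Fin k → LevelPartition G) →
    (∀ i → RootedAt G (P i) v) →
    (∀ i j → i ≢ j → LevelDisjoint G (P i) (P j)) →
    ((¬ Bipartite G) → MaxHeight G P (e + (k ∸ 1)) → s ≤ e + 2)
    × (Bipartite G → MaxHeight G P (e + (2 * k ∸ 2)) → s ≤ e + 3)
proposition11 _ _ _ _ _ (suc zero) (s≤s ()) _ _ _ _ _
proposition11 G _ s (cycle , girth) v (suc (suc k)) _ e _ P rooted disjoint =
  (λ _ (h≤ , _) → ≤-trans (s≤1+ℓ (∃-ℓ≤1+e e h≤)) (≤-reflexive (+-comm 2 e))) ,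
  (λ (col , proper) (h≤ , _) → ≤-trans (s≤1+ℓ (∃-ℓ≤2+e col proper e h≤)) (≤-reflexive (+-comm 3 e)))
  where
    open RootNeighbour G P rooted disjoint cycle

    s≤1+ℓ : ∀ {L} → (∃ λ i → ℓ (fsuc i) ≤ L) → s ≤ suc L
    s≤1+ℓ (i , ℓ≤L) = ≤-trans (girth _ (cycle-through-y i)) (s≤s ℓ≤L)
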